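{- Let $\mathsf X\subseteq\{\mathsf M,\mathsf{M_0},\mathsf P,\mathsf{P_0},\mathsf R\}$ and let $\mathcal D$ be a finite set of formulas closed under subformulas and single negations with $\top\in\mathcal D$. Then the $\mathsf{ILX}$-structure $\mathfrak M=(W,R,\{S_w:w\in W\},\Vdash)$ for $\mathcal D$ is a generalized Veltman model, and for every $G\in\mathcal D$ and every $w\in W$: $\mathfrak M,w\Vdash G$ if and only if $G\in w$.
   Context: Modal formulas are built from propositional variables, $\bot$, $\to$ and binary $\rhd$; $\Box A$ abbreviates $\neg A\rhd\bot$, $\Diamond A$ abbreviates $\neg\Box\neg A$. $\mathsf{IL}$ has as axioms all instances of classical tautologies and of: $\Box(A\to B)\to(\Box A\to\Box B)$; $\Box(\Box A\to A)\to\Box A$; $\Box(A\to B)\to A\rhd B$; $(A\rhd B)\wedge(B\rhd C)\to A\rhd C$; $(A\rhd C)\wedge(B\rhd C)\to A\vee B\rhd C$; $A\rhd B\to(\Diamond A\to\Diamond B)$; $\Diamond A\rhd A$; rules modus ponens and necessitation. For $\mathsf X$ a set of principles, $\mathsf{ILX}$ is $\mathsf{IL}$ plus all instances of the schemata in $\mathsf X$, where $\mathsf M$: $A\rhd B\to A\wedge\Box C\rhd B\wedge\Box C$; $\mathsf{M_0}$: $A\rhd B\to\Diamond A\wedge\Box C\rhd B\wedge\Box C$; $\mathsf P$: $A\rhd B\to\Box(A\rhd B)$; $\mathsf{P_0}$: $A\rhd\Diamond B\to\Box(A\rhd B)$; $\mathsf R$: $A\rhd B\to\neg(A\rhd\neg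 C)\rhd B\wedge\Box C$. "Closed under single negations" means: if $B\in\mathcal D$ then ${\sim}B\in\mathcal D$, where ${\sim}B=C$ if $B=\neg C$ and ${\sim}B=\neg B$ otherwise. An $\mathsf{ILX}$-MCS is a maximal $\mathsf{ILX}$-consistent set of formulas. For $\mathsf{ILX}$-MCSs $w,u$ and a set of formulas $S$, write $w\prec_S u$ if for every finite $S'\subseteq S$ and every formula $A$, $A\rhd\bigvee_{G\in S'}\neg G\in w$ implies $\neg A\in u$ and $\Box\neg A\in u$ (the empty disjunction is $\bot$); $w\prec u$ means $w\prec_\emptyset u$. The $\mathsf{ILX}$-structure for $\mathcal D$ is: $W$ = the set of $\mathsf{ILX}$-MCSs $w$ such that $G\wedge\Box\neg G\in w$ for some $G\in\mathcal D$; $wRu$ iff $w\prec u$; $uS_wV$ iff $wRu$, $V\subseteq R[w]$ (where $R[w]=\{x\in W:wRx\}$), and for every set of formulas $S$ with $w\prec_S u$ there is $v\in V$ with $w\prec_S v$; $w\Vdash p$ iff $p\in w$. A generalized Veltman model is $(W,R,\{S_w\},\Vdash)$ with $W\neq\emptyset$, $R$ transitive and conversely well-founded, and for each $w$: (a) $S_w\subseteq R[w]\times(\mathcal P(R[w])\setminus\{\emptyset\})$; (b) $wRu$ implies $uS_w\{u\}$; (c) if $uS_wV$ and $vS_wZ_v$ for all $v\in V$ then $uS_w\bigcup_{v\in V}Z_v$; (d) if $wRu$ and $uRv$ then $uS_w\{v\}$; (e) if $uS_wV$ and $V\subseteq Z\subseteq R[w]$ then $uS_wZ$; forcing is classical for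 Boolean connectives and $w\Vdash A\rhd B$ iff for every $u$ with $wRu$ and $u\Vdash A$ there is $V$ with $uS_wV$ and $v\Vdash B$ for all $v\in V$. -}

module Defs where

open import Level using (Level; _⊔_; Lift) renaming (suc to lsuc; zero to lzero)
open import Data.Nat using (ℕ)
open import Data.Bool using (Bool; true; false; not; _∨_)
open import Data.List using (List; []; _∷_; map; foldr)
open import Data.List.Membership.Propositional using (_∈_)
open import Data.List.Relation.Unary.All using (All)
open import Data.Product using (Σ; _×_; ∃)
open import Data.Empty using (⊥)
open import Relation.Binary.PropositionalEquality using (_≡_)
open import Relation.Nullary using (¬_)
open import Induction.WellFounded using (WellFounded)

infixr 5 _⇒_
infix 6 _▷_

data Fm : Set where
  var  : ℕ → Fm
  ⊥'   : Fm
  _⇒_  : Fm → Fm → Fm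
  _▷_  : Fm → Fm → Fm

¬' : Fm → Fm
¬' A = A ⇒ ⊥'

⊤' : Fm
⊤' = ¬' ⊥'

_∨'_ : Fm → Fm → Fm
A ∨' B = ¬' A ⇒ B

_∧'_ : Fm → Fm → Fm
A ∧' B = ¬' (A ⇒ ¬' B)

□ : Fm → Fm
□ A = ¬' A ▷ ⊥'

◇ : Fm → Fm
◇ A = ¬' (□ (¬' A))

∼ : Fm → Fm
∼ (var p)   = ¬' (var p)
∼ ⊥'        = ¬' ⊥'
∼ (A ⇒ ⊥')  = A
∼ (A ⇒ B)   = ¬' (A ⇒ B)
∼ (A ▷ B)   = ¬' (A ▷ B)

-- Classical tautologies: formulas true under every Boolean valuation in
-- which variables and ▷-formulas are treated as atoms (equivalently,
-- substitution instances of propositional tautologies).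

eval : (Fm → Bool) → Fm → Bool
eval v (var p) = v (var p)
eval v ⊥'      = false
eval v (A ⇒ B) = not (eval v A) ∨ eval v B
eval v (A ▷ B) = v (A ▷ B)

Tautology : Fm → Set
Tautology A = (v : Fm → Bool) → eval v A ≡ true

data Principle : Set where
  M M₀ P P₀ R : Principle

data _⊢_ (X : List Principle) : Fm → Set where
  taut : ∀ {A} → Tautology A → X ⊢ A
  axK  : ∀ {A B} → X ⊢ (□ (A ⇒ B) ⇒ (□ A ⇒ □ B))
  axL  : ∀ {A} → X ⊢ (□ (□ A ⇒ A) ⇒ □ A)
  axJ1 : ∀ {A B} → X ⊢ (□ (A ⇒ B) ⇒ (A ▷ B))
  axJ2 : ∀ {A B C} → X ⊢ (((A ▷ B) ∧' (B ▷ C)) ⇒ (A ▷ C))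
  axJ3 : ∀ {A B C} → X ⊢ (((A ▷ C) ∧' (B ▷ C)) ⇒ ((A ∨' B) ▷ C))
  axJ4 : ∀ {A B} → X ⊢ ((A ▷ B) ⇒ (◇ A ⇒ ◇ B))
  axJ5 : ∀ {A} → X ⊢ (◇ A ▷ A)
  axM  : ∀ {A B C} → M ∈ X → X ⊢ ((A ▷ B) ⇒ ((A ∧' □ C) ▷ (B ∧' □ C)))
  axM₀ : ∀ {A B C} → M₀ ∈ X → X ⊢ ((A ▷ B) ⇒ ((◇ A ∧' □ C) ▷ (B ∧' □ C)))
  axP  : ∀ {A B} → P ∈ X → X ⊢ ((A ▷ B) ⇒ □ (A ▷ B))
  axP₀ : ∀ {A B} → P₀ ∈ X → X ⊢ ((A ▷ ◇ B) ⇒ □ (A ▷ B))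
  axR  : ∀ {A B C} → R ∈ X → X ⊢ ((A ▷ B) ⇒ (¬' (A ▷ ¬' C) ▷ (B ∧' □ C)))
  mp   : ∀ {A B} → X ⊢ (A ⇒ B) → X ⊢ A → X ⊢ B
  nec  : ∀ {A} → X ⊢ A → X ⊢ □ A

FmSet : Set₁
FmSet = Fm → Set

_⊆F_ : FmSet → FmSet → Set
Γ ⊆F Δ = ∀ A → Γ A → Δ A

imps : List Fm → Fm → Fm
imps []       B = B
imps (A ∷ As) B = A ⇒ imps As B

Consistent : List Principle → FmSet → Set
Consistent X Γ = (As : List Fm) → All Γ As → ¬ (X ⊢ imps As ⊥')

MCS : List Principle → FmSet → Set₁
MCS X Γ = Consistent X Γ × ((Δ : FmSet) → Γ ⊆F Δ → Consistent X Δ → Δ ⊆F Γ)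

ClosedSubformulas : List Fm → Set
ClosedSubformulas D =
  (∀ A B → (A ⇒ B) ∈ D → A ∈ D × B ∈ D) ×
  (∀ A B → (A ▷ B) ∈ D → A ∈ D × B ∈ D)

ClosedSingleNeg : List Fm → Set
ClosedSingleNeg D = ∀ B → B ∈ D → ∼ B ∈ D

record GenVeltmanFrame (a : Level) : Set (lsuc a) where
  field
    W : Set a
    Rel : W → W → Set a
    S : W → W → (W → Set a) → Set a

Union : ∀ {a} {W : Set a} (V : W → Set a) → ((v : W) → V v → W → Set a) → W → Set a
Union {W = W} V Z x = Σ W λ v → Σ (V v) λ p → Z v p x

record IsGenVeltmanModel {a : Level} (F : GenVeltmanFrame a) : Set (lsuc a) where
  open GenVeltmanFrame F
  field
    nonempty    : W
    trans       : ∀ {x y z} → Rel x y → Rel y z → Rel x z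
    convWF      : WellFounded (λ y x → Rel x y)
    condA       : ∀ w u V → S w u V →
                    Rel w u × (∀ v → V v → Rel w v) × Σ W V
    condB       : ∀ w u → Rel w u → S w u (λ x → Lift a (x ≡ u))
    condC       : ∀ w u (V : W → Set a) (Z : (v : W) → V v → W → Set a) →
                    S w u V → (∀ v (p : V v) → S w v (Z v p)) →
                    S w u (Union V Z)
    condD       : ∀ w u v → Rel w u → Rel u v → S w u (λ x → Lift a (x ≡ v))
    condE       : ∀ w u (V Z : W → Set a) → S w u V →
                    (∀ x → V x → Z x) → (∀ x → Z x → Rel w x) → S w u Z

module Forcing {a : Level} (F : GenVeltmanFrame a) (val : GenVeltmanFrame.W F → ℕ → Set a) where
  open GenVeltmanFrame F
  _⊩_ : W → Fm → Set (lsuc a)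
  w ⊩ var p   = Lift (lsuc a) (val w p)
  w ⊩ ⊥'      = Lift (lsuc a) ⊥
  w ⊩ (A ⇒ B) = w ⊩ A → w ⊩ B
  w ⊩ (A ▷ B) = ∀ u → Rel w u → u ⊩ A →
                  Σ (W → Set a) λ V → S w u V × (∀ v → V v → v ⊩ B)

module ILXStructure (X : List Principle) (D : List Fm) where

  record World : Set₁ where
    constructor world
    field
      set    : FmSet
      isMCS  : MCS X set
      gen    : Σ Fm λ G → G ∈ D × set (G ∧' □ (¬' G))
  open World public

  disj : List Fm → Fm
  disj = foldr _∨'_ ⊥'

  Prec : FmSet → World → World → Set
  Prec S w u = (S' : List Fm) → All S S' → (A : Fm) →
               set w (A ▷ disj (map ¬' S')) →
               set u (¬' A) × set u (□ (¬' A))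

  Rel : World → World → Set₁
  Rel w u = Lift (lsuc lzero) (Prec (λ _ → ⊥) w u)

  Sw : World → World → (World → Set₁) → Set₁
  Sw w u V = Rel w u × (∀ v → V v → Rel w v) ×
             ((S : FmSet) → Prec S w u → Σ World λ v → V v × Prec S w v)

  frame : GenVeltmanFrame (lsuc lzero)
  frame = record { W = World ; Rel = Rel ; S = Sw }

  val : World → ℕ → Set₁
  val w p = Lift (lsuc lzero) (set w (var p))

  open Forcing frame val public

-- The ILX-structure for a finite adequate set D is a generalized Veltman
-- model satisfying the truth lemma (for every X: no principle of X is used).

module Submission where

open import Defs
open import Level using (Level; Lift; lift; lower) renaming (zero to lzero; suc to lsuc)
open import Data.Bool using (Bool; true; false; not; _∨_)
open import Data.Nat using (ℕ; zero; suc; _≤_; _<_; _∸_; _⊔_; z≤n; s≤s; _≤′_; ≤′-reflexive; ≤′-step)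
open import Data.Nat.Properties using (≤⇒≤′; m≤m⊔n; m≤n⊔m; m≤n⇒m≤1+n; ∸-monoʳ-<)
open import Data.Nat.Induction using (<-wellFounded)
open import Data.List using (List; []; _∷_; map; foldr; _++_; length; cartesianProductWith)
open import Data.List.Membership.Propositional using (_∈_)
open import Data.List.Membership.Propositional.Properties using (∈-++⁺ˡ; ∈-++⁺ʳ; ∈-cartesianProductWith⁺)
open import Data.List.Relation.Unary.All as All using (All; []; _∷_)
open import Data.List.Relation.Unary.All.Properties using (++⁺; ++⁻)
open import Data.List.Relation.Unary.Any using (Any; here; there)
import Data.List.Relation.Unary.Any.Properties as Any
open import Data.Product using (Σ; _×_; _,_; proj₁; proj₂)
open import Data.Sum using (_⊎_; inj₁; inj₂)
open import Data.Empty using (⊥; ⊥-elim)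
open import Relation.Binary.PropositionalEquality using (_≡_; refl; sym; trans)
open import Relation.Nullary using (¬_; yes; no)
open import Induction.WellFounded using (WellFounded; module Subrelation)
import Relation.Binary.Construct.On as On
open import Axiom.ExcludedMiddle using (ExcludedMiddle)
open import Function using (_∘_; flip)

-- 1. Boolean reasoning and derivations.

-- Truth of a formula under a Boolean valuation (variables and ▷-formulas
-- are atoms); a record so that the valuation can be inferred.
record Tr (v : Fm → Bool) (A : Fm) : Set where
  constructor mk
  field get : eval v A ≡ true
open Tr

_⊨_ : List Fm → Fm → Set
Ds ⊨ E = ∀ v → All (Tr v) Ds → Tr v E

⋁¬ : List Fm → Fm
⋁¬ S' = foldr _∨'_ ⊥' (map ¬' S')

false≢true : false ≡ true → ⊥
false≢true ()

⇒-true : ∀ a b → (a ≡ true → b ≡ true) → not a ∨ b ≡ true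
⇒-true false b f = refl
⇒-true true  b f = f refl

⇒-elim : ∀ a b → not a ∨ b ≡ true → a ≡ true → b ≡ true
⇒-elim true b h refl = h

module _ {v : Fm → Bool} where

  excluded : ∀ A → Tr v A ⊎ ¬ Tr v A
  excluded A with eval v A in eq
  ... | true  = inj₁ (mk eq)
  ... | false = inj₂ λ t → false≢true (trans (sym eq) (get t))

  ¬¬E : ∀ {A} → ¬ ¬ Tr v A → Tr v A
  ¬¬E {A} nn with excluded A
  ... | inj₁ a  = a
  ... | inj₂ na = ⊥-elim (nn na)

  ⇒I : ∀ {A B} → (Tr v A → Tr v B) → Tr v (A ⇒ B)
  ⇒I {A} {B} f = mk (⇒-true (eval v A) (eval v B) (λ a → get (f (mk a))))

  ⇒E : ∀ {A B} → Tr v (A ⇒ B) → Tr v A → Tr v B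
  ⇒E {A} {B} (mk h) (mk a) = mk (⇒-elim (eval v A) (eval v B) h a)

  ⊥E : ¬ Tr v ⊥'
  ⊥E (mk ())

  ¬I : ∀ {A} → ¬ Tr v A → Tr v (¬' A)
  ¬I f = ⇒I (λ a → ⊥-elim (f a))

  ¬E : ∀ {A} → Tr v (¬' A) → ¬ Tr v A
  ¬E h a = ⊥E (⇒E h a)

  ∧I : ∀ {A B} → Tr v A → Tr v B → Tr v (A ∧' B)
  ∧I a b = ¬I (λ h → ¬E (⇒E h a) b)

  ∧E₁ : ∀ {A B} → Tr v (A ∧' B) → Tr v A
  ∧E₁ h = ¬¬E (λ na → ¬E h (⇒I (λ a → ⊥-elim (na a))))

  ∧E₂ : ∀ {A B} → Tr v (A ∧' B) → Tr v B
  ∧E₂ h = ¬¬E (λ nb → ¬E h (⇒I (λ _ → ¬I nb)))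

  ∨I₁ : ∀ {A B} → Tr v A → Tr v (A ∨' B)
  ∨I₁ a = ⇒I (λ na → ⊥-elim (¬E na a))

  ∨I₂ : ∀ {A B} → Tr v B → Tr v (A ∨' B)
  ∨I₂ b = ⇒I (λ _ → b)

  ∨E : ∀ {A B} → Tr v (A ∨' B) → Tr v A ⊎ Tr v B
  ∨E {A} h with excluded A
  ... | inj₁ a  = inj₁ a
  ... | inj₂ na = inj₂ (⇒E h (¬I na))

  ¬¬-elim : ∀ {A} → Tr v (¬' (¬' A)) → Tr v A
  ¬¬-elim h = ¬¬E (λ na → ¬E h (¬I na))

  ¬¬-intro : ∀ {A} → Tr v A → Tr v (¬' (¬' A))
  ¬¬-intro a = ¬I (λ na → ¬E na a)

  impsI : ∀ As {C} → (All (Tr v) As → Tr v C) → Tr v (imps As C)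
  impsI []       f = f []
  impsI (A ∷ As) f = ⇒I (λ a → impsI As (λ as → f (a ∷ as)))

  impsE : ∀ As {C} → Tr v (imps As C) → All (Tr v) As → Tr v C
  impsE []       h []       = h
  impsE (A ∷ As) h (a ∷ as) = impsE As (⇒E h a) as

  ⋁I : ∀ L → Any (Tr v) L → Tr v (foldr _∨'_ ⊥' L)
  ⋁I (x ∷ L) (here p)  = ∨I₁ p
  ⋁I (x ∷ L) (there p) = ∨I₂ (⋁I L p)

  ⋁E : ∀ L → Tr v (foldr _∨'_ ⊥' L) → Any (Tr v) L
  ⋁E []      h = ⊥-elim (⊥E h)
  ⋁E (x ∷ L) h with ∨E h
  ... | inj₁ a = here a
  ... | inj₂ b = there (⋁E L b)

  ¬⋁¬⇒All : ∀ L → ¬ Tr v (⋁¬ L) → All (Tr v) L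
  ¬⋁¬⇒All []      _ = []
  ¬⋁¬⇒All (x ∷ L) h = ¬¬E (λ nx → h (∨I₁ (¬I nx))) ∷ ¬⋁¬⇒All L (λ d → h (∨I₂ d))

  ⋁¬-++ˡ : ∀ xs {ys} → Tr v (⋁¬ xs) → Tr v (⋁¬ (xs ++ ys))
  ⋁¬-++ˡ xs {ys} t = ⋁I _ (Any.map⁺ (Any.++⁺ˡ (Any.map⁻ {xs = xs} (⋁E _ t))))

  ⋁¬-++ʳ : ∀ xs {ys} → Tr v (⋁¬ ys) → Tr v (⋁¬ (xs ++ ys))
  ⋁¬-++ʳ xs {ys} t = ⋁I _ (Any.map⁺ (Any.++⁺ʳ xs (Any.map⁻ {xs = ys} (⋁E _ t))))

  ⋁¬-single : ∀ {B} S' → All (_≡ ¬' B) S' → Tr v (⋁¬ S') → Tr v B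
  ⋁¬-single S' eqs t = go S' eqs (⋁E _ t)
    where
    go : ∀ {B} S' → All (_≡ ¬' B) S' → Any (Tr v) (map ¬' S') → Tr v B
    go (s ∷ S') (refl ∷ _)   (here x)  = ¬¬-elim x
    go (s ∷ S') (_    ∷ eqs) (there x) = go S' eqs x

derive : ∀ {X Ds E} → All (X ⊢_) Ds → Ds ⊨ E → X ⊢ E
derive {Ds = Ds} ds f = apply ds (taut (λ v → get (impsI Ds (f v))))
  where
  apply : ∀ {X Ds E} → All (X ⊢_) Ds → X ⊢ imps Ds E → X ⊢ E
  apply []       d = d
  apply (p ∷ ps) d = apply ps (mp d p)

tautology : ∀ {X A} → [] ⊨ A → X ⊢ A
tautology = derive []

▷-rule : ∀ {X A B} → X ⊢ (A ⇒ B) → X ⊢ (A ▷ B)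
▷-rule d = mp axJ1 (nec d)

□-mono : ∀ {X A B} → X ⊢ (A ⇒ B) → X ⊢ (□ A ⇒ □ B)
□-mono d = mp axK (nec d)

-- A list of hypotheses from Aside ∪ Rest with the Aside-ones set aside:
-- the kept ones lie in Rest, and all are true once the Aside-ones are.
record Split (Aside Rest : Fm → Set) (Bs : List Fm) : Set where
  field
    kept    : List Fm
    keptAll : All Rest kept
    restore : ∀ v → All (Tr v) kept → (∀ b → Aside b → Tr v b) → All (Tr v) Bs

split : ∀ (Aside Rest : Fm → Set) Bs → All (λ b → Aside b ⊎ Rest b) Bs → Split Aside Rest Bs
split _ _ [] [] = record { kept = [] ; keptAll = [] ; restore = λ _ _ _ → [] }
split Aside Rest (b ∷ Bs) (inj₁ ab ∷ hs) = record
  { kept    = kept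
  ; keptAll = keptAll
  ; restore = λ v ts as → as b ab ∷ restore v ts as }
  where open Split (split Aside Rest Bs hs)
split Aside Rest (b ∷ Bs) (inj₂ rb ∷ hs) = record
  { kept    = b ∷ kept
  ; keptAll = rb ∷ keptAll
  ; restore = λ { v (t ∷ ts) as → t ∷ restore v ts as } }
  where open Split (split Aside Rest Bs hs)

_,,_ : FmSet → Fm → FmSet
(Γ ,, B) F = F ≡ B ⊎ Γ F

-- 2. An enumeration of all formulas, for Lindenbaum's lemma.

forms : ℕ → List Fm
forms zero    = ⊥' ∷ var zero ∷ []
forms (suc n) = var (suc n) ∷ (forms n ++ (cartesianProductWith _⇒_ (forms n) (forms n)
                                         ++ cartesianProductWith _▷_ (forms n) (forms n)))

forms-mono : ∀ {A n m} → n ≤ m → A ∈ forms n → A ∈ forms m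
forms-mono le = go (≤⇒≤′ le)
  where
  go : ∀ {A n m} → n ≤′ m → A ∈ forms n → A ∈ forms m
  go (≤′-reflexive refl) p = p
  go (≤′-step le)        p = there (∈-++⁺ˡ (go le p))

enumerated : ∀ A → Σ ℕ λ n → A ∈ forms n
enumerated (var zero)    = zero , there (here refl)
enumerated (var (suc k)) = suc k , here refl
enumerated ⊥'            = zero , here refl
enumerated (A ⇒ B) with enumerated A | enumerated B
... | n , p | m , q = suc (n ⊔ m) , there (∈-++⁺ʳ (forms (n ⊔ m)) (∈-++⁺ˡ
      (∈-cartesianProductWith⁺ _⇒_ (forms-mono (m≤m⊔n n m) p) (forms-mono (m≤n⊔m n m) q))))
enumerated (A ▷ B) with enumerated A | enumerated B
... | n , p | m , q = suc (n ⊔ m) , there (∈-++⁺ʳ (forms (n ⊔ m)) (∈-++⁺ʳ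
      (cartesianProductWith _⇒_ (forms (n ⊔ m)) (forms (n ⊔ m)))
      (∈-cartesianProductWith⁺ _▷_ (forms-mono (m≤m⊔n n m) p) (forms-mono (m≤n⊔m n m) q))))

module MaximalConsistent (lem : ∀ {ℓ} → ExcludedMiddle ℓ) (X : List Principle) where

  discharge : ∀ {Γ B C} Bs → All (Γ ,, B) Bs → X ⊢ imps Bs C →
              Σ (List Fm) λ Bs' → All Γ Bs' × X ⊢ imps Bs' (B ⇒ C)
  discharge {Γ} {B} Bs hs d = kept , keptAll ,
    derive (d ∷ []) λ { v (h ∷ []) →
      impsI kept λ ts → ⇒I λ tb → impsE Bs h (restore v ts λ { _ refl → tb }) }
    where open Split (split (_≡ B) Γ Bs hs)

  consistent-⊆ : ∀ {Γ Δ} → Γ ⊆F Δ → Consistent X Δ → Consistent X Γ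
  consistent-⊆ sub c As hs = c As (All.map (λ {x} → sub x) hs)

  inconsistency : ∀ {Δ} → ¬ Consistent X Δ →
                  Σ (List Fm) λ As → All Δ As × X ⊢ imps As ⊥'
  inconsistency {Δ} nc with lem {P = Σ (List Fm) λ As → All Δ As × X ⊢ imps As ⊥'}
  ... | yes p = p
  ... | no np = ⊥-elim (nc (λ As hs d → np (As , hs , d)))

  module MCSProperties {Γ : FmSet} (m : MCS X Γ) where

    closed : ∀ As {B} → All Γ As → X ⊢ imps As B → Γ B
    closed As {B} hs d = proj₂ m (Γ ,, B) (λ _ → inj₂) consistent B (inj₁ refl)
      where
      consistent : Consistent X (Γ ,, B)
      consistent Bs hs' e with discharge Bs hs' e
      ... | Bs' , hs'' , e' = proj₁ m (Bs' ++ As) (++⁺ hs'' hs)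
        (derive (e' ∷ d ∷ []) λ { v (h₁ ∷ h₂ ∷ []) → impsI (Bs' ++ As) λ ts →
           let (t₁ , t₂) = ++⁻ Bs' ts in ⇒E (impsE Bs' h₁ t₁) (impsE As h₂ t₂) })

    theorem : ∀ {A} → X ⊢ A → Γ A
    theorem d = closed [] [] d

    entail₁ : ∀ {A B} → Γ A → (∀ v → Tr v A → Tr v B) → Γ B
    entail₁ a f = closed (_ ∷ []) (a ∷ []) (tautology λ v _ → ⇒I (f v))

    entail₂ : ∀ {A B C} → Γ A → Γ B → (∀ v → Tr v A → Tr v B → Tr v C) → Γ C
    entail₂ a b f = closed (_ ∷ _ ∷ []) (a ∷ b ∷ []) (tautology λ v _ → ⇒I λ x → ⇒I (f v x))

    entail₃ : ∀ {A B C E} → Γ A → Γ B → Γ C →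
              (∀ v → Tr v A → Tr v B → Tr v C → Tr v E) → Γ E
    entail₃ a b c f = closed (_ ∷ _ ∷ _ ∷ []) (a ∷ b ∷ c ∷ [])
      (tautology λ v _ → ⇒I λ x → ⇒I λ y → ⇒I (f v x y))

    not-both : ∀ {A} → Γ A → Γ (¬' A) → ⊥
    not-both {A} a na = proj₁ m (_ ∷ _ ∷ []) (a ∷ na ∷ [])
      (tautology λ v _ → ⇒I λ x → ⇒I λ y → ⊥-elim (¬E y x))

    no-⊥ : ¬ Γ ⊥'
    no-⊥ b = proj₁ m (_ ∷ []) (b ∷ []) (tautology λ v _ → ⇒I λ x → x)

    negation : ∀ {A} → ¬ Γ A → Γ (¬' A)
    negation {A} ∉ with lem {P = Consistent X (Γ ,, A)}
    ... | yes c = ⊥-elim (∉ (proj₂ m (Γ ,, A) (λ _ → inj₂) c A (inj₁ refl)))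
    ... | no nc with inconsistency nc
    ... | Bs , hs , d with discharge Bs hs d
    ... | Bs' , hs' , d' = closed Bs' hs' d'

    ▷-trans : ∀ {A B C} → Γ (A ▷ B) → Γ (B ▷ C) → Γ (A ▷ C)
    ▷-trans a b = entail₃ (theorem axJ2) a b (λ v t x y → ⇒E t (∧I x y))

    ▷-join : ∀ {A B C} → Γ (A ▷ C) → Γ (B ▷ C) → Γ ((A ∨' B) ▷ C)
    ▷-join a b = entail₃ (theorem axJ3) a b (λ v t x y → ⇒E t (∧I x y))

    ▷-taut : ∀ {A B} → (∀ v → Tr v A → Tr v B) → Γ (A ▷ B)
    ▷-taut f = theorem (▷-rule (tautology λ v _ → ⇒I (f v)))

    ▷-löb : ∀ {A} → Γ (A ▷ (A ∧' □ (¬' A)))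
    ▷-löb {A} = ▷-trans (theorem (▷-rule A⇒F∨◇F)) (▷-join (▷-taut λ v x → x) (theorem axJ5))
      where
      F = A ∧' □ (¬' A)
      -- □¬F is □(□¬A → ¬A) up to Boolean equivalence, so Löb gives □¬A.
      □¬F⇒□¬A : X ⊢ (□ (¬' F) ⇒ □ (¬' A))
      □¬F⇒□¬A = derive (□-mono (tautology λ v _ → ⇒I λ nf → ⇒I λ b → ¬I λ a → ¬E nf (∧I a b))
                        ∷ axL ∷ [])
        λ { v (h₁ ∷ h₂ ∷ []) → ⇒I λ x → ⇒E h₂ (⇒E h₁ x) }
      A⇒F∨◇F : X ⊢ (A ⇒ (F ∨' ◇ F))
      A⇒F∨◇F = derive (□¬F⇒□¬A ∷ []) λ { v (h ∷ []) → ⇒I λ a → case v h a (excluded (□ (¬' A))) }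
        where
        case : ∀ v → Tr v (□ (¬' F) ⇒ □ (¬' A)) → Tr v A →
               Tr v (□ (¬' A)) ⊎ ¬ Tr v (□ (¬' A)) → Tr v (F ∨' ◇ F)
        case v h a (inj₁ b)  = ∨I₁ (∧I a b)
        case v h a (inj₂ nb) = ∨I₂ (¬I λ c → nb (⇒E h c))

  module Lindenbaum (Θ : FmSet) (consΘ : Consistent X Θ) where

    add : FmSet → Fm → FmSet
    add Γ A B = Γ B ⊎ (B ≡ A × Consistent X (Γ ,, A))

    add-consistent : ∀ Γ A → Consistent X Γ → Consistent X (add Γ A)
    add-consistent Γ A c with lem {P = Consistent X (Γ ,, A)}
    ... | yes c' = consistent-⊆ (λ { B (inj₁ g) → inj₂ g ; B (inj₂ (e , _)) → inj₁ e }) c'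
    ... | no n   = consistent-⊆ (λ { B (inj₁ g) → g ; B (inj₂ (_ , c')) → ⊥-elim (n c') }) c

    addAll : FmSet → List Fm → FmSet
    addAll Γ []       = Γ
    addAll Γ (A ∷ As) = addAll (add Γ A) As

    addAll-⊇ : ∀ Γ As → Γ ⊆F addAll Γ As
    addAll-⊇ Γ []       B g = g
    addAll-⊇ Γ (A ∷ As) B g = addAll-⊇ (add Γ A) As B (inj₁ g)

    addAll-consistent : ∀ Γ As → Consistent X Γ → Consistent X (addAll Γ As)
    addAll-consistent Γ []       c = c
    addAll-consistent Γ (A ∷ As) c = addAll-consistent (add Γ A) As (add-consistent Γ A c)

    addAll-maximal : ∀ {Δ A} Γ L → A ∈ L → Δ A → Consistent X Δ → addAll Γ L ⊆F Δ → addAll Γ L A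
    addAll-maximal {Δ} {A} Γ (B ∷ L) (here refl) d cΔ sub =
      addAll-⊇ (add Γ A) L A (inj₂ (refl , consistent-⊆ Γ,,A⊆Δ cΔ))
      where
      Γ,,A⊆Δ : (Γ ,, A) ⊆F Δ
      Γ,,A⊆Δ F (inj₁ refl) = d
      Γ,,A⊆Δ F (inj₂ g)    = sub F (addAll-⊇ (add Γ A) L F (inj₁ g))
    addAll-maximal Γ (B ∷ L) (there p) d cΔ sub = addAll-maximal (add Γ B) L p d cΔ sub

    stage : ℕ → FmSet
    stage zero    = Θ
    stage (suc n) = addAll (stage n) (forms n)

    stage-consistent : ∀ n → Consistent X (stage n)
    stage-consistent zero    = consΘ
    stage-consistent (suc n) = addAll-consistent (stage n) (forms n) (stage-consistent n)

    stage-mono : ∀ {n m} → n ≤ m → stage n ⊆F stage m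
    stage-mono le = go (≤⇒≤′ le)
      where
      go : ∀ {n m} → n ≤′ m → stage n ⊆F stage m
      go (≤′-reflexive refl) B g = g
      go {m = suc m} (≤′-step le) B g = addAll-⊇ (stage m) (forms m) B (go le B g)

    limit : FmSet
    limit A = Σ ℕ λ n → stage n A

    common-stage : ∀ As → All limit As → Σ ℕ λ n → All (stage n) As
    common-stage []       []              = zero , []
    common-stage (A ∷ As) ((k , p) ∷ hs) with common-stage As hs
    ... | n , qs = k ⊔ n , stage-mono (m≤m⊔n k n) A p ∷ All.map (λ {x} → stage-mono (m≤n⊔m k n) x) qs

    limit-MCS : MCS X limit
    limit-MCS = consistent , maximal
      where
      consistent : Consistent X limit
      consistent As hs d with common-stage As hs
      ... | n , qs = stage-consistent n As qs d
      maximal : (Δ : FmSet) → limit ⊆F Δ → Consistent X Δ → Δ ⊆F limit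
      maximal Δ sub cΔ A d with enumerated A
      ... | n , p = suc n , addAll-maximal (stage n) (forms n) p d cΔ (λ B g → sub B (suc n , g))

  lindenbaum : ∀ Θ → Consistent X Θ → Σ FmSet λ Γ → MCS X Γ × Θ ⊆F Γ
  lindenbaum Θ c = limit , limit-MCS , λ B g → zero , g
    where open Lindenbaum Θ c

module Counting (lem : ∀ {ℓ} → ExcludedMiddle ℓ) {A : Set} where

  count : (A → Set) → List A → ℕ
  count Q []      = 0
  count Q (x ∷ L) with lem {P = Q x}
  ... | yes _ = suc (count Q L)
  ... | no  _ = count Q L

  count-≤ : ∀ Q L → count Q L ≤ length L
  count-≤ Q []      = z≤n
  count-≤ Q (x ∷ L) with lem {P = Q x}
  ... | yes _ = s≤s (count-≤ Q L)
  ... | no  _ = m≤n⇒m≤1+n (count-≤ Q L)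

  count-mono : ∀ {Q Q'} → (∀ x → Q x → Q' x) → ∀ L → count Q L ≤ count Q' L
  count-mono f []      = z≤n
  count-mono {Q} {Q'} f (x ∷ L) with lem {P = Q x} | lem {P = Q' x}
  ... | yes _ | yes _ = s≤s (count-mono f L)
  ... | yes q | no q' = ⊥-elim (q' (f x q))
  ... | no  _ | yes _ = m≤n⇒m≤1+n (count-mono f L)
  ... | no  _ | no  _ = count-mono f L

  count-strict : ∀ {Q Q'} → (∀ x → Q x → Q' x) → ∀ {y} L → y ∈ L → Q' y → ¬ Q y →
                 count Q L < count Q' L
  count-strict {Q} {Q'} f (x ∷ L) (here refl) q'y ¬qy with lem {P = Q x} | lem {P = Q' x}
  ... | yes q | _     = ⊥-elim (¬qy q)
  ... | no  _ | yes _ = s≤s (count-mono f L)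
  ... | no  _ | no q' = ⊥-elim (q' q'y)
  count-strict {Q} {Q'} f (x ∷ L) (there p) q'y ¬qy with lem {P = Q x} | lem {P = Q' x}
  ... | yes _ | yes _ = s≤s (count-strict f L p q'y ¬qy)
  ... | yes q | no q' = ⊥-elim (q' (f x q))
  ... | no  _ | yes _ = m≤n⇒m≤1+n (count-strict f L p q'y ¬qy)
  ... | no  _ | no  _ = count-strict f L p q'y ¬qy

-- 3. The ILX-structure for D.

module Structure (lem : ∀ {ℓ} → ExcludedMiddle ℓ) (X : List Principle) (D : List Fm) where
  open ILXStructure X D
  open MaximalConsistent lem X
  open MCSProperties using (entail₁; entail₂; theorem; not-both)

  -- If u R v and □¬C ∈ u then ¬C, □¬C ∈ v (take A = ¬¬C in u ≺ v).
  R-□¬ : ∀ {u v C} → Rel u v → set u (□ (¬' C)) → set v (¬' C) × set v (□ (¬' C))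
  R-□¬ {u} {v} (lift u≺v) b =
    let (n , bn) = u≺v [] [] (¬' (¬' _)) b in
    entail₁ (isMCS v) n (λ _ → ¬¬-elim) ,
    entail₂ (isMCS v) (theorem (isMCS v) (□-mono (tautology λ _ _ → ⇒I ¬¬-elim))) bn (λ _ → ⇒E)

  ≺-R : ∀ {S w u v} → Prec S w u → Rel u v → Prec S w v
  ≺-R {u = u} {v} w≺u uRv S' S'⊆S C h = R-□¬ {u} {v} uRv (proj₂ (w≺u S' S'⊆S C h))

  ≺⇒R : ∀ {S w u} → Prec S w u → Rel w u
  ≺⇒R w≺u = lift λ S' S'⊆∅ → w≺u S' (All.map ⊥-elim S'⊆∅)

  R-trans : ∀ {w u v} → Rel w u → Rel u v → Rel w v
  R-trans {w} {u} {v} (lift w≺u) uRv = lift (≺-R {w = w} {u} {v} w≺u uRv)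

  module Existence (w : World) (S : FmSet) (E : Fm) (E∈D : E ∈ D)
                   (none : ∀ S' → All S S' → ¬ set w (E ▷ ⋁¬ S')) where
    open MCSProperties (isMCS w) using (▷-trans; ▷-join; ▷-taut; ▷-löb)

    Required : FmSet
    Required b = Σ Fm λ C → Σ (List Fm) λ S' →
                 All S S' × set w (C ▷ ⋁¬ S') × (b ≡ ¬' C ⊎ b ≡ □ (¬' C))

    Generator : FmSet
    Generator b = b ≡ E ⊎ b ≡ □ (¬' E)

    Θ : FmSet
    Θ b = Generator b ⊎ Required b

    required-▷ : ∀ b → Required b → Σ (List Fm) λ S' → All S S' × set w (¬' b ▷ ⋁¬ S')
    required-▷ b (C , S' , S'⊆S , h , inj₁ refl) = S' , S'⊆S , ▷-trans (▷-taut λ _ → ¬¬-elim) h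
    required-▷ b (C , S' , S'⊆S , h , inj₂ refl) = S' , S'⊆S , ▷-trans (theorem (isMCS w) axJ5) h

    required-⋁▷ : ∀ Bs → All Required Bs → Σ (List Fm) λ S' → All S S' × set w (⋁¬ Bs ▷ ⋁¬ S')
    required-⋁▷ []       []       = [] , [] , ▷-taut λ _ x → x
    required-⋁▷ (b ∷ Bs) (r ∷ rs) with required-▷ b r | required-⋁▷ Bs rs
    ... | Sb , Sb⊆S , hb | Ss , Ss⊆S , hs = Sb ++ Ss , ++⁺ Sb⊆S Ss⊆S ,
          ▷-join (▷-trans hb (▷-taut λ _ → ⋁¬-++ˡ Sb)) (▷-trans hs (▷-taut λ _ → ⋁¬-++ʳ Sb))

    -- Θ is consistent: an inconsistency would give E ∧ □¬E → ⋁¬Bs' for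
    -- some Bs' ⊆ Required, whence E ▷ E ∧ □¬E ▷ ⋁¬Bs' ▷ ⋁¬S'.
    Θ-consistent : Consistent X Θ
    Θ-consistent Bs hs d =
      let (S' , S'⊆S , h) = required-⋁▷ kept keptAll in
      none S' S'⊆S (▷-trans ▷-löb (▷-trans (theorem (isMCS w) (▷-rule generator⇒⋁¬)) h))
      where
      open Split (split Generator Required Bs hs)
      generator⇒⋁¬ : X ⊢ ((E ∧' □ (¬' E)) ⇒ ⋁¬ kept)
      generator⇒⋁¬ = derive (d ∷ []) λ { v (h ∷ []) → ⇒I λ f → ¬¬E λ n →
        ⊥E (impsE Bs h (restore v (¬⋁¬⇒All kept n) λ { _ (inj₁ refl) → ∧E₁ f ; _ (inj₂ refl) → ∧E₂ f })) }

    witness : Σ World λ u → set u E × Prec S w u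
    witness with lindenbaum Θ Θ-consistent
    ... | Γ , Γ-MCS , Θ⊆Γ =
      world Γ Γ-MCS (E , E∈D , entail₂ Γ-MCS E∈Γ □¬E∈Γ (λ _ → ∧I)) , E∈Γ ,
      λ S' S'⊆S C h → Θ⊆Γ _ (inj₂ (C , S' , S'⊆S , h , inj₁ refl)) ,
                      Θ⊆Γ _ (inj₂ (C , S' , S'⊆S , h , inj₂ refl))
      where
      E∈Γ = Θ⊆Γ E (inj₁ (inj₁ refl))
      □¬E∈Γ = Θ⊆Γ (□ (¬' E)) (inj₁ (inj₂ refl))

  existence : ∀ w S E → E ∈ D → (∀ S' → All S S' → ¬ set w (E ▷ ⋁¬ S')) →
              Σ World λ u → set u E × Prec S w u
  existence w S E E∈D none = Existence.witness w S E E∈D none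

  -- 4. The generalized Veltman model conditions.

  -- The valuation making every variable false and every ▷-formula true;
  -- all ILX-theorems hold under it, since every non-Boolean axiom is an
  -- implication chain ending in a ▷-formula.
  v₀ : Fm → Bool
  v₀ (var _) = false
  v₀ _       = true

  sound-v₀ : ∀ {A} → X ⊢ A → Tr v₀ A
  sound-v₀ (taut t)  = mk (t v₀)
  sound-v₀ axK       = mk refl
  sound-v₀ axL       = mk refl
  sound-v₀ axJ1      = mk refl
  sound-v₀ axJ2      = mk refl
  sound-v₀ axJ3      = mk refl
  sound-v₀ axJ4      = mk refl
  sound-v₀ axJ5      = mk refl
  sound-v₀ (axM _)   = mk refl
  sound-v₀ (axM₀ _)  = mk refl
  sound-v₀ (axP _)   = mk refl
  sound-v₀ (axP₀ _)  = mk refl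
  sound-v₀ (axR _)   = mk refl
  sound-v₀ (mp d e)  = ⇒E (sound-v₀ d) (sound-v₀ e)
  sound-v₀ (nec d)   = mk refl

  v₀-MCS : MCS X (Tr v₀)
  v₀-MCS = (λ As hs d → ⊥E (impsE As (sound-v₀ d) hs)) ,
           λ Δ sub cΔ A d → ¬¬E λ n → cΔ (_ ∷ _ ∷ []) (d ∷ sub _ (¬I n) ∷ [])
             (tautology λ v _ → ⇒I λ x → ⇒I λ y → ⊥-elim (¬E y x))

  -- Converse well-foundedness: along R the number of G ∈ D with □¬G
  -- strictly grows (such formulas persist by R-□¬, and the generator G of
  -- the successor is new), and it is bounded by the length of D.
  open Counting lem using (count; count-≤; count-strict)

  Refutes : World → Fm → Set
  Refutes w G = set w (□ (¬' G))

  R-count : ∀ {w u} → Rel w u → count (Refutes w) D < count (Refutes u) D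
  R-count {w} {u} wRu with gen u
  ... | G , G∈D , g = count-strict (λ _ → proj₂ ∘ R-□¬ {w} {u} wRu) D G∈D
        (entail₁ (isMCS u) g (λ _ → ∧E₂))
        (λ b → not-both (isMCS u) (entail₁ (isMCS u) g (λ _ → ∧E₁)) (proj₁ (R-□¬ {w} {u} wRu b)))

  R-conversely-wf : WellFounded (λ u w → Rel w u)
  R-conversely-wf = Subrelation.wellFounded (λ {u} {w} wRu → decreasing {w} {u} wRu)
                      (On.wellFounded unrefuted <-wellFounded)
    where
    unrefuted : World → ℕ
    unrefuted w = length D ∸ count (Refutes w) D
    decreasing : ∀ {w u} → Rel w u → unrefuted u < unrefuted w
    decreasing {w} {u} wRu = ∸-monoʳ-< (R-count {w} {u} wRu) (count-≤ (Refutes u) D)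

  model : ⊤' ∈ D → IsGenVeltmanModel frame
  model ⊤∈D = record
    { nonempty = world (Tr v₀) v₀-MCS (⊤' , ⊤∈D , mk refl)
    ; trans    = λ {w} {u} {v} → R-trans {w} {u} {v}
    ; convWF   = R-conversely-wf
    ; condA    = λ { w u V (wRu , V⊆R , h) →
                   let (v , v∈V , _) = h (λ _ → ⊥) (lower wRu) in wRu , V⊆R , v , v∈V }
    ; condB    = λ w u wRu → wRu , (λ { v (lift refl) → wRu }) , λ S w≺u → u , lift refl , w≺u
    ; condC    = λ { w u V Z (wRu , V⊆R , h) k →
                   wRu , (λ { v (x , x∈V , v∈Z) → proj₁ (proj₂ (k x x∈V)) v v∈Z }) ,
                   λ S w≺u → let (x , x∈V , w≺x) = h S w≺u
                                 (z , z∈Z , w≺z) = proj₂ (proj₂ (k x x∈V)) S w≺x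
                             in z , (x , x∈V , z∈Z) , w≺z }
    ; condD    = λ w u v wRu uRv → wRu , (λ { x (lift refl) → R-trans {w} {u} {v} wRu uRv }) ,
                   λ S w≺u → v , lift refl , ≺-R {S} {w} {u} {v} w≺u uRv
    ; condE    = λ { w u V Z (wRu , _ , h) V⊆Z Z⊆R → wRu , Z⊆R ,
                   λ S w≺u → let (x , x∈V , w≺x) = h S w≺u in x , V⊆Z x x∈V , w≺x }
    }

  -- 5. The truth lemma.

  Truth : Fm → Set₂
  Truth G = ∀ w → (w ⊩ G → set w G) × (set w G → w ⊩ G)

  ⇒-truth : ∀ {A B} → Truth A → Truth B → Truth (A ⇒ B)
  ⇒-truth {A} {B} tA tB w = forced⇒member , member⇒forced
    where
    forced⇒member : w ⊩ (A ⇒ B) → set w (A ⇒ B)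
    forced⇒member f with lem {P = set w A}
    ... | yes a = entail₁ (isMCS w) (proj₁ (tB w) (f (proj₂ (tA w) a))) (λ _ b → ⇒I λ _ → b)
    ... | no na = entail₁ (isMCS w) (MCSProperties.negation (isMCS w) na) (λ _ n → ⇒I λ a → ⊥-elim (¬E n a))
    member⇒forced : set w (A ⇒ B) → w ⊩ (A ⇒ B)
    member⇒forced h fa = proj₂ (tB w) (entail₂ (isMCS w) (proj₁ (tA w) fa) h (λ _ → flip ⇒E))

  -- A ▷ B ∈ w, w R u and A ∈ u: the successors of w containing B form a
  -- set V with u S_w V by the existence lemma, whose hypothesis holds since
  -- B ▷ ⋁¬S' ∈ w would give A ▷ ⋁¬S' ∈ w and hence ¬A ∈ u when w ≺_S u.
  ▷-member⇒forced : ∀ {A B} → B ∈ D → Truth A → Truth B → ∀ w → set w (A ▷ B) → w ⊩ (A ▷ B)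
  ▷-member⇒forced {A} {B} B∈D tA tB w A▷B u wRu u⊩A =
    containsB , (wRu , (λ _ → proj₁) , reach) , λ v v∈V → proj₂ (tB v) (lower (proj₂ v∈V))
    where
    containsB : World → Set₁
    containsB v = Rel w v × Lift (lsuc lzero) (set v B)
    reach : (S : FmSet) → Prec S w u → Σ World λ v → containsB v × Prec S w v
    reach S w≺u =
      let (v , B∈v , w≺v) = existence w S B B∈D λ S' S'⊆S B▷ →
            not-both (isMCS u) (proj₁ (tA u) u⊩A)
              (proj₁ (w≺u S' S'⊆S A (MCSProperties.▷-trans (isMCS w) A▷B B▷)))
      in v , (≺⇒R {S} {w} {v} w≺v , lift B∈v) , w≺v

  -- If A ▷ B ∉ w, the existence lemma with S = {¬B} gives u ∋ A with
  -- w ≺_{¬B} u; any V with u S_w V then meets a v with w ≺_{¬B} v, so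
  -- ¬B ∈ v (as B ▷ ¬¬B ∈ w), and v cannot force B.
  ▷-forced⇒member : ∀ {A B} → A ∈ D → Truth A → Truth B → ∀ w → w ⊩ (A ▷ B) → set w (A ▷ B)
  ▷-forced⇒member {A} {B} A∈D tA tB w f with lem {P = set w (A ▷ B)}
  ... | yes A▷B = A▷B
  ... | no ¬A▷B =
    let (u , A∈u , w≺u) = existence w (_≡ ¬' B) A A∈D λ S' S'≡¬B A▷⋁ →
          not-both (isMCS w) (▷-trans A▷⋁ (▷-taut λ _ → ⋁¬-single S' S'≡¬B)) (negation ¬A▷B)
        (V , (_ , _ , reach) , V⊩B) = f u (≺⇒R {_} {w} {u} w≺u) (proj₂ (tA u) A∈u)
        (v , v∈V , w≺v) = reach (_≡ ¬' B) w≺u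
    in ⊥-elim (not-both (isMCS v) (proj₁ (tB v) (V⊩B v v∈V))
                 (proj₁ (w≺v (¬' B ∷ []) (refl ∷ []) B (▷-taut λ _ x → ∨I₁ (¬¬-intro x)))))
    where open MCSProperties (isMCS w) using (▷-trans; ▷-taut; negation)

  truth : ClosedSubformulas D → ∀ G → G ∈ D → Truth G
  truth _ (var p) _ w = lower ∘ lower , lift ∘ lift
  truth _ ⊥'      _ w = (λ ()) , λ b → ⊥-elim (MCSProperties.no-⊥ (isMCS w) b)
  truth closed (A ⇒ B) A⇒B∈D =
    let (A∈D , B∈D) = proj₁ closed A B A⇒B∈D in
    ⇒-truth (truth closed A A∈D) (truth closed B B∈D)
  truth closed (A ▷ B) A▷B∈D w =
    let (A∈D , B∈D) = proj₂ closed A B A▷B∈D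
        tA = truth closed A A∈D
        tB = truth closed B B∈D
    in ▷-forced⇒member A∈D tA tB w , ▷-member⇒forced B∈D tA tB w

mainTheorem12 : (lem : ∀ {ℓ : Level} → ExcludedMiddle ℓ) →
    (X : List Principle) → (D : List Fm) →
    ClosedSubformulas D → ClosedSingleNeg D → ⊤' ∈ D →
    IsGenVeltmanModel (ILXStructure.frame X D) ×
    (∀ G → G ∈ D → ∀ (w : ILXStructure.World X D) →
    (ILXStructure._⊩_ X D w G → ILXStructure.set w G) ×
    (ILXStructure.set w G → ILXStructure._⊩_ X D w G))
mainTheorem12 lem X D closed _ ⊤∈D = model ⊤∈D , λ G G∈D → truth closed G G∈D
  where open Structure lem X D using (model; truth)
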